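{- Let $m$ be a positive integer, let $n = 2^m - 1$, and let $k$ be an integer with $k \geq n$. For any two vertices $x, y \in \{1, 2, \ldots, n\}$ of the path graph $P_n$, the number of walks in $P_n$ of length $k$ that start at $x$ and end at $y$ is even.
   Context: The path graph $P_n$ has vertex set $\{1,2,\ldots,n\}$, and two vertices are joined by an edge if and only if they are consecutive integers; a vertex is not adjacent to itself. A walk of length $k$ from $x$ to $y$ is a sequence of vertices $x = x_0, x_1, \ldots, x_k = y$ such that $x_{i}$ and $x_{i+1}$ are adjacent for each $i = 0, \ldots, k-1$. -}

module Defs where

open import Data.Nat using (ℕ; zero; suc)
open import Data.Fin using (Fin; toℕ)
open import Data.Sum using (_⊎_)
open import Relation.Binary.PropositionalEquality using (_≡_)

-- Vertices of the path graph P_n are represented by Fin n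
-- (Fin n element i stands for vertex i+1 of {1,...,n}).
-- Two vertices are adjacent iff they are consecutive integers.
Adj : {n : ℕ} → Fin n → Fin n → Set
Adj u v = suc (toℕ u) ≡ toℕ v ⊎ suc (toℕ v) ≡ toℕ u

data Walk {n : ℕ} : ℕ → Fin n → Fin n → Set where
  here : (x : Fin n) → Walk zero x x
  step : {k : ℕ} {x y : Fin n} (z : Fin n) → Adj x z → Walk k z y → Walk (suc k) x y

-- Walks are counted by the usual recursion over the first step, so
-- Walk k x y is in bijection with Fin (walks n k x y).  Reducing modulo 2
-- (the `parity` homomorphism ℕ → Parity = GF(2)), the column of walk
-- parities ending at y evolves by the adjacency operator A_n of P_n over
-- GF(2).  Hence it suffices that A_n is nilpotent of index ≤ n, i.e.
-- A_n^n v vanishes on the vertices for every vector v.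
--
-- Nilpotency is proved by induction on m.  For M = 2N+1, split the
-- positions {0,…,2N} into the N odd ones and the N+1 even ones; every edge
-- joins an odd to an even position, and A_M² restricted to the odd
-- positions is exactly A_N.  Thus A_M^(2N) acts on the odd positions as
-- A_N^N = 0, and one more application of A_M kills the even positions too.
--
-- Vertex i+1 of P_n is represented by i ∈ {0,…,n-1}; vectors over GF(2)
-- are functions ℕ → Parity of which only the values below n matter.
-- The argument works for every m (for m = 0 there are no vertices).
module Submission where

open import Defs
open import Data.Nat using (ℕ; suc; _+_; _*_; _∸_; _^_; _≤_)
open import Data.Fin using (Fin)
open import Data.Product using (∃)
open import Function.Bundles using (_↔_)
open import Data.Nat using (zero; _<_; _<ᵇ_; _≡ᵇ_; parity)
open import Data.Nat.Properties
  using (+-suc; +-identityʳ; *-suc; *-distribʳ-+; m+[n∸m]≡n; m^n>0; <⇒<ᵇ;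
         ≡⇒≡ᵇ; ≡ᵇ⇒≡; ≡-irrelevant; +-commutativeSemigroup)
open import Data.Nat.GeneralisedArithmetic using (fold; fold-+)
open import Algebra.Properties.CommutativeSemigroup +-commutativeSemigroup
  using (interchange)
open import Data.Parity.Base using (Parity; 0ℙ) renaming (_+_ to _⊕_)
open import Data.Parity.Properties using (p+p≡0ℙ; +-homo-+) renaming (+-assoc to ⊕-assoc)
open import Data.Fin using (toℕ) renaming (zero to fzero; suc to fsuc)
open import Data.Fin.Properties using (+↔⊎; *↔×; toℕ-injective; toℕ<n) renaming (_≟_ to _≟ᶠ_)
open import Data.Bool using (Bool; true; false; T; if_then_else_)
open import Data.Unit using (tt)
open import Data.Empty using (⊥-elim)
open import Data.Product using (Σ; _×_; _,_)
open import Data.Sum using (_⊎_; inj₁; inj₂)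
open import Data.Sum.Function.Propositional using (_⊎-↔_)
open import Data.Product.Function.NonDependent.Propositional using (_×-↔_)
open import Function.Bundles using (mk↔ₛ′)
open import Function.Properties.Inverse using (↔-trans; ↔-sym)
open import Axiom.UniquenessOfIdentityProofs using (module Decidable⇒UIP)
open import Relation.Nullary using (Irrelevant)
open import Relation.Binary.PropositionalEquality
  using (_≡_; refl; sym; trans; cong; cong₂; subst; _≗_; module ≡-Reasoning)
open ≡-Reasoning

[_] : Bool → ℕ
[ b ] = if b then 1 else 0

sumBelow : ℕ → (ℕ → ℕ) → ℕ
sumBelow zero    f = 0
sumBelow (suc N) f = f 0 + sumBelow N (λ z → f (suc z))

adjCount : ℕ → ℕ → ℕ
adjCount a b = [ suc a ≡ᵇ b ] + [ a ≡ᵇ suc b ]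

walks : ℕ → ℕ → ℕ → ℕ → ℕ
walks N zero    x y = [ x ≡ᵇ y ]
walks N (suc k) x y = sumBelow N (λ z → adjCount x z * walks N k z y)

prop↔indicator : {P : Set} (b : Bool) → Irrelevant P → (P → T b) → (T b → P) → P ↔ Fin [ b ]
prop↔indicator true  irr to from =
  mk↔ₛ′ (λ _ → fzero) (λ _ → from tt) (λ { fzero → refl ; (fsuc ()) }) (λ p → irr _ p)
prop↔indicator false irr to from =
  mk↔ₛ′ (λ p → ⊥-elim (to p)) (λ ()) (λ ()) (λ p → ⊥-elim (to p))

Σ↔sumBelow : ∀ N {B : Fin N → Set} (f : ℕ → ℕ) →
  (∀ z → B z ↔ Fin (f (toℕ z))) → Σ (Fin N) B ↔ Fin (sumBelow N f)
Σ↔sumBelow zero    f size = mk↔ₛ′ (λ { (() , _) }) (λ ()) (λ ()) (λ { (() , _) })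
Σ↔sumBelow (suc N) {B} f size =
  ↔-trans splitFirst
    (↔-trans (size fzero ⊎-↔ Σ↔sumBelow N (λ z → f (suc z)) (λ z → size (fsuc z)))
             (↔-sym (+↔⊎ {f 0})))
  where
  splitFirst : Σ (Fin (suc N)) B ↔ (B fzero ⊎ Σ (Fin N) (λ z → B (fsuc z)))
  splitFirst = mk↔ₛ′ (λ { (fzero , p) → inj₁ p ; (fsuc z , p) → inj₂ (z , p) })
                     (λ { (inj₁ p) → fzero , p ; (inj₂ (z , p)) → fsuc z , p })
                     (λ { (inj₁ p) → refl ; (inj₂ (z , p)) → refl })
                     (λ { (fzero , p) → refl ; (fsuc z , p) → refl })

module _ {N : ℕ} where

  ≡↔indicator : (x y : Fin N) → (x ≡ y) ↔ Fin [ toℕ x ≡ᵇ toℕ y ]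
  ≡↔indicator x y = prop↔indicator _ (Decidable⇒UIP.≡-irrelevant _≟ᶠ_)
    (λ e → ≡⇒≡ᵇ _ _ (cong toℕ e)) (λ t → toℕ-injective (≡ᵇ⇒≡ _ _ t))

  Adj↔adjCount : (x z : Fin N) → Adj x z ↔ Fin (adjCount (toℕ x) (toℕ z))
  Adj↔adjCount x z =
    ↔-trans (prop↔indicator _ ≡-irrelevant (≡⇒≡ᵇ _ _) (≡ᵇ⇒≡ _ _)
             ⊎-↔ prop↔indicator _ ≡-irrelevant (λ e → ≡⇒≡ᵇ _ _ (sym e)) (λ t → sym (≡ᵇ⇒≡ _ _ t)))
            (↔-sym (+↔⊎ {[ suc (toℕ x) ≡ᵇ toℕ z ]}))

  walk-zero↔ : (x y : Fin N) → Walk zero x y ↔ (x ≡ y)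
  walk-zero↔ x y = mk↔ₛ′ (λ { (here _) → refl }) (λ { refl → here x })
                         (λ { refl → refl }) (λ { (here _) → refl })

  walk-suc↔ : ∀ k (x y : Fin N) → Walk (suc k) x y ↔ Σ (Fin N) (λ z → Adj x z × Walk k z y)
  walk-suc↔ k x y = mk↔ₛ′ (λ { (step z a w) → z , a , w }) (λ { (z , a , w) → step z a w })
                          (λ { (z , a , w) → refl }) (λ { (step z a w) → refl })

Walk↔walks : ∀ N k (x y : Fin N) → Walk k x y ↔ Fin (walks N k (toℕ x) (toℕ y))
Walk↔walks N zero    x y = ↔-trans (walk-zero↔ x y) (≡↔indicator x y)
Walk↔walks N (suc k) x y = ↔-trans (walk-suc↔ k x y)
  (Σ↔sumBelow N (λ z → adjCount (toℕ x) z * walks N k z (toℕ y))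
    (λ z → ↔-trans (Adj↔adjCount x z ×-↔ Walk↔walks N k z y)
                   (↔-sym (*↔× {adjCount (toℕ x) (toℕ z)}))))

Vector : Set
Vector = ℕ → Parity

restrict : ℕ → Vector → Vector
restrict N v x = if x <ᵇ N then v x else 0ℙ

left : Vector → Vector
left v zero    = 0ℙ
left v (suc x) = v x

-- Sum over the neighbours of x in P_N: for x < N this is the adjacency matrix
-- of P_N over GF(2) applied to v; the operator only reads v below N.
adjacency : ℕ → Vector → Vector
adjacency N v x = restrict N v (suc x) ⊕ left (restrict N v) x

restrict-cong : ∀ N {v w : Vector} → v ≗ w → restrict N v ≗ restrict N w
restrict-cong N v≗w x = cong (λ a → if x <ᵇ N then a else 0ℙ) (v≗w x)

left-cong : ∀ {v w : Vector} → v ≗ w → left v ≗ left w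
left-cong v≗w zero    = refl
left-cong v≗w (suc x) = v≗w x

adjacency-cong : ∀ N {v w : Vector} → v ≗ w → adjacency N v ≗ adjacency N w
adjacency-cong N v≗w x =
  cong₂ _⊕_ (restrict-cong N v≗w (suc x)) (left-cong (restrict-cong N v≗w) x)

parity-if : ∀ b n → parity (if b then n else 0) ≡ (if b then parity n else 0ℙ)
parity-if true  n = refl
parity-if false n = refl

sumBelow-cong : ∀ N {f g : ℕ → ℕ} → (∀ z → f z ≡ g z) → sumBelow N f ≡ sumBelow N g
sumBelow-cong zero    f≗g = refl
sumBelow-cong (suc N) f≗g = cong₂ _+_ (f≗g 0) (sumBelow-cong N (λ z → f≗g (suc z)))

sumBelow-zero : ∀ N → sumBelow N (λ _ → 0) ≡ 0
sumBelow-zero zero    = refl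
sumBelow-zero (suc N) = sumBelow-zero N

sumBelow-+ : ∀ N (f g : ℕ → ℕ) → sumBelow N (λ z → f z + g z) ≡ sumBelow N f + sumBelow N g
sumBelow-+ zero    f g = refl
sumBelow-+ (suc N) f g = begin
  f 0 + g 0 + sumBelow N (λ z → f (suc z) + g (suc z))
    ≡⟨ cong (f 0 + g 0 +_) (sumBelow-+ N (λ z → f (suc z)) (λ z → g (suc z))) ⟩
  f 0 + g 0 + (sumBelow N (λ z → f (suc z)) + sumBelow N (λ z → g (suc z)))
    ≡⟨ interchange (f 0) (g 0) _ _ ⟩
  f 0 + sumBelow N (λ z → f (suc z)) + (g 0 + sumBelow N (λ z → g (suc z))) ∎

sumBelow-pick : ∀ N t (c : ℕ → ℕ) →
  sumBelow N (λ z → [ t ≡ᵇ z ] * c z) ≡ (if t <ᵇ N then c t else 0)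
sumBelow-pick zero    t       c = refl
sumBelow-pick (suc N) zero    c = begin
  c 0 + 0 + sumBelow N (λ _ → 0) ≡⟨ cong₂ _+_ (+-identityʳ (c 0)) (sumBelow-zero N) ⟩
  c 0 + 0                         ≡⟨ +-identityʳ (c 0) ⟩
  c 0                             ∎
sumBelow-pick (suc N) (suc t) c = sumBelow-pick N t (λ z → c (suc z))

parity-pick : ∀ N t (c : ℕ → ℕ) →
  parity (sumBelow N (λ z → [ t ≡ᵇ z ] * c z)) ≡ restrict N (λ z → parity (c z)) t
parity-pick N t c = trans (cong parity (sumBelow-pick N t c)) (parity-if (t <ᵇ N) (c t))

parity-pick-left : ∀ N x (c : ℕ → ℕ) →
  parity (sumBelow N (λ z → [ x ≡ᵇ suc z ] * c z)) ≡ left (restrict N (λ z → parity (c z))) x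
parity-pick-left N zero    c = cong parity (sumBelow-zero N)
parity-pick-left N (suc x) c = parity-pick N x c

parity-step : ∀ N x (c : ℕ → ℕ) →
  parity (sumBelow N (λ z → adjCount x z * c z)) ≡ adjacency N (λ z → parity (c z)) x
parity-step N x c = begin
  parity (sumBelow N (λ z → adjCount x z * c z))
    ≡⟨ cong parity (sumBelow-cong N (λ z → *-distribʳ-+ (c z) [ suc x ≡ᵇ z ] [ x ≡ᵇ suc z ])) ⟩
  parity (sumBelow N (λ z → [ suc x ≡ᵇ z ] * c z + [ x ≡ᵇ suc z ] * c z))
    ≡⟨ cong parity (sumBelow-+ N _ _) ⟩
  parity (toRight + toLeft)
    ≡⟨ +-homo-+ toRight toLeft ⟩
  parity toRight ⊕ parity toLeft
    ≡⟨ cong₂ _⊕_ (parity-pick N (suc x) c) (parity-pick-left N x c) ⟩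
  adjacency N (λ z → parity (c z)) x ∎
  where
  toRight toLeft : ℕ
  toRight = sumBelow N (λ z → [ suc x ≡ᵇ z ] * c z)
  toLeft  = sumBelow N (λ z → [ x ≡ᵇ suc z ] * c z)

walks-parity : ∀ N k y →
  (λ x → parity (walks N k x y)) ≗ fold (λ x → parity (walks N zero x y)) (adjacency N) k
walks-parity N zero    y x = refl
walks-parity N (suc k) y x =
  trans (parity-step N x (λ z → walks N k z y)) (adjacency-cong N (walks-parity N k y) x)

Nilpotent : ℕ → Set
Nilpotent N = ∀ v → restrict N (fold v (adjacency N) N) ≗ λ _ → 0ℙ

oddPart evenPart : Vector → Vector
oddPart  v i = v (suc (i + i))
evenPart v i = v (i + i)

data EvenOdd : ℕ → Set where
  even : ∀ i → EvenOdd (i + i)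
  odd  : ∀ i → EvenOdd (suc (i + i))

evenOdd : ∀ x → EvenOdd x
evenOdd zero = even 0
evenOdd (suc x) with evenOdd x
... | even i = odd i
... | odd  i rewrite sym (+-suc i i) = even (suc i)

double-<ᵇ : ∀ i N → (i + i <ᵇ N + N) ≡ (i <ᵇ N)
double-<ᵇ zero    zero    = refl
double-<ᵇ zero    (suc N) = refl
double-<ᵇ (suc i) zero    = refl
double-<ᵇ (suc i) (suc N) rewrite +-suc i i | +-suc N N = double-<ᵇ i N

suc-double-<ᵇ : ∀ i N → (suc (i + i) <ᵇ N + N) ≡ (i <ᵇ N)
suc-double-<ᵇ i       zero    = refl
suc-double-<ᵇ zero    (suc N) rewrite +-suc N N = refl
suc-double-<ᵇ (suc i) (suc N) rewrite +-suc i i | +-suc N N = suc-double-<ᵇ i N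

<ᵇ-false-suc : ∀ m n → (m <ᵇ n) ≡ false → (suc m <ᵇ n) ≡ false
<ᵇ-false-suc m       zero    _ = refl
<ᵇ-false-suc zero    (suc n) ()
<ᵇ-false-suc (suc m) (suc n) m≮n = <ᵇ-false-suc m n m≮n

-- Below M = 2N+1 lie N odd and N+1 even positions.
oddPart-restrict : ∀ N v → oddPart (restrict (suc (N + N)) v) ≗ restrict N (oddPart v)
oddPart-restrict N v i rewrite double-<ᵇ i N = refl

evenPart-restrict : ∀ N v → evenPart (restrict (suc (N + N)) v) ≗ restrict (suc N) (evenPart v)
evenPart-restrict N v zero = refl
evenPart-restrict N v (suc i) rewrite +-suc i i | suc-double-<ᵇ i N = refl

left-evenPart : ∀ v i → left v (i + i) ≡ left (oddPart v) i
left-evenPart v zero    = refl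
left-evenPart v (suc i) = cong v (+-suc i i)

-- The value at the even position 2i of A_M applied to a vector living on the
-- odd positions (u i sitting at 2i+1): the sum over the odd neighbours
-- 2i-1, 2i+1.
up : ℕ → Vector → Vector
up N u i = restrict N u i ⊕ left (restrict N u) i

-- Dually, the value at the odd position 2i+1 of A_M applied to a vector on the
-- N+1 even positions (e i sitting at 2i): the sum over the even neighbours
-- 2i, 2i+2.
down : ℕ → Vector → Vector
down N e i = restrict (suc N) e (suc i) ⊕ restrict (suc N) e i

-- Each edge of P_M joins an odd and an even position.
evenPart-adjacency : ∀ N v → evenPart (adjacency (suc (N + N)) v) ≗ up N (oddPart v)
evenPart-adjacency N v i = cong₂ _⊕_ (oddPart-restrict N v i)
  (trans (left-evenPart (restrict (suc (N + N)) v) i) (left-cong (oddPart-restrict N v) i))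

oddPart-adjacency : ∀ N v → oddPart (adjacency (suc (N + N)) v) ≗ down N (evenPart v)
oddPart-adjacency N v i = cong₂ _⊕_
  (trans (cong (restrict (suc (N + N)) v) (sym (+-suc (suc i) i))) (evenPart-restrict N v (suc i)))
  (evenPart-restrict N v i)

up-support : ∀ N u → restrict (suc N) (up N u) ≗ up N u
up-support N u i with i <ᵇ suc N in i≤N
... | true = refl
up-support N u zero    | false with () ← i≤N
up-support N u (suc i) | false rewrite <ᵇ-false-suc i N i≤N | i≤N = refl

up-vanishes : ∀ N u → restrict N u ≗ (λ _ → 0ℙ) → up N u ≗ λ _ → 0ℙ
up-vanishes N u u≗0 zero    = cong (_⊕ 0ℙ) (u≗0 zero)
up-vanishes N u u≗0 (suc i) = cong₂ _⊕_ (u≗0 (suc i)) (u≗0 i)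

down-cong : ∀ N {e e' : Vector} → e ≗ e' → down N e ≗ down N e'
down-cong N e≗e' i = cong₂ _⊕_ (restrict-cong (suc N) e≗e' (suc i)) (restrict-cong (suc N) e≗e' i)

⊕-cancel-middle : ∀ a b c → (a ⊕ b) ⊕ (b ⊕ c) ≡ a ⊕ c
⊕-cancel-middle a b c = begin
  (a ⊕ b) ⊕ (b ⊕ c) ≡⟨ ⊕-assoc a b (b ⊕ c) ⟩
  a ⊕ (b ⊕ (b ⊕ c)) ≡⟨ cong (a ⊕_) (sym (⊕-assoc b b c)) ⟩
  a ⊕ ((b ⊕ b) ⊕ c) ≡⟨ cong (λ p → a ⊕ (p ⊕ c)) (p+p≡0ℙ b) ⟩
  a ⊕ c             ∎

-- Going from the odd positions to the even ones and back is A_N: the middle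
-- vertex is counted twice and cancels.
down-up : ∀ N u → down N (up N u) ≗ adjacency N u
down-up N u i = begin
  down N (up N u) i
    ≡⟨ cong₂ _⊕_ (up-support N u (suc i)) (up-support N u i) ⟩
  (r (suc i) ⊕ r i) ⊕ (r i ⊕ left r i)
    ≡⟨ ⊕-cancel-middle (r (suc i)) (r i) (left r i) ⟩
  adjacency N u i ∎
  where
  r : Vector
  r = restrict N u

oddPart-adjacency² : ∀ N v →
  oddPart (adjacency (suc (N + N)) (adjacency (suc (N + N)) v)) ≗ adjacency N (oddPart v)
oddPart-adjacency² N v i = begin
  oddPart (adjacency M (adjacency M v)) i ≡⟨ oddPart-adjacency N (adjacency M v) i ⟩
  down N (evenPart (adjacency M v)) i     ≡⟨ down-cong N (evenPart-adjacency N v) i ⟩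
  down N (up N (oddPart v)) i             ≡⟨ down-up N (oddPart v) i ⟩
  adjacency N (oddPart v) i               ∎
  where
  M : ℕ
  M = suc (N + N)

oddPart-iterate : ∀ N j v →
  oddPart (fold v (adjacency (suc (N + N))) (j + j)) ≗ fold (oddPart v) (adjacency N) j
oddPart-iterate N zero    v i = refl
oddPart-iterate N (suc j) v i rewrite +-suc j j =
  trans (oddPart-adjacency² N (fold v (adjacency (suc (N + N))) (j + j)) i)
        (adjacency-cong N (oddPart-iterate N j v) i)

fold-suc : ∀ {A : Set} (z : A) (s : A → A) n → fold z s (suc n) ≡ fold (s z) s n
fold-suc z s zero    = refl
fold-suc z s (suc n) = cong s (fold-suc z s n)

nilpotent-zero : Nilpotent 0
nilpotent-zero v i = refl

-- If A_N^N = 0 then A_M^M = 0 for M = 2N+1: A_M^(2N) is A_N^N on the odd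
-- positions, and the even positions only see odd ones.
nilpotent-double : ∀ N → Nilpotent N → Nilpotent (suc (N + N))
nilpotent-double N nil v x = atPosition (evenOdd x)
  where
  M : ℕ
  M = suc (N + N)
  A : Vector → Vector
  A = adjacency M
  atPosition : ∀ {x} → EvenOdd x → restrict M (fold v A M) x ≡ 0ℙ
  atPosition (odd i) = begin
    oddPart (restrict M (fold v A M)) i                ≡⟨ oddPart-restrict N (fold v A M) i ⟩
    restrict N (oddPart (fold v A M)) i                ≡⟨ cong (λ w → restrict N (oddPart w) i) (fold-suc v A (N + N)) ⟩
    restrict N (oddPart (fold (A v) A (N + N))) i      ≡⟨ restrict-cong N (oddPart-iterate N N (A v)) i ⟩
    restrict N (fold (oddPart (A v)) (adjacency N) N) i ≡⟨ nil (oddPart (A v)) i ⟩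
    0ℙ                                                 ∎
  atPosition (even i) = begin
    evenPart (restrict M (A w)) i         ≡⟨ evenPart-restrict N (A w) i ⟩
    restrict (suc N) (evenPart (A w)) i   ≡⟨ restrict-cong (suc N) (evenPart-adjacency N w) i ⟩
    restrict (suc N) (up N (oddPart w)) i ≡⟨ up-support N (oddPart w) i ⟩
    up N (oddPart w) i                    ≡⟨ up-vanishes N (oddPart w) oddPart-vanishes i ⟩
    0ℙ                                    ∎
    where
    w : Vector
    w = fold v A (N + N)
    oddPart-vanishes : restrict N (oddPart w) ≗ λ _ → 0ℙ
    oddPart-vanishes j = trans (restrict-cong N (oddPart-iterate N N v) j) (nil (oddPart v) j)

2*p∸1 : ∀ p → 0 < p → 2 * p ∸ 1 ≡ suc ((p ∸ 1) + (p ∸ 1))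
2*p∸1 (suc q) _ = begin
  q + suc (q + 0) ≡⟨ +-suc q (q + 0) ⟩
  suc (q + (q + 0)) ≡⟨ cong (λ r → suc (q + r)) (+-identityʳ q) ⟩
  suc (q + q) ∎

nilpotent-2^m-1 : ∀ m → Nilpotent (2 ^ m ∸ 1)
nilpotent-2^m-1 zero    = nilpotent-zero
nilpotent-2^m-1 (suc m) = subst Nilpotent (sym (2*p∸1 (2 ^ m) (m^n>0 2 m)))
  (nilpotent-double (2 ^ m ∸ 1) (nilpotent-2^m-1 m))

restrict-below : ∀ N v {x} → x < N → restrict N v x ≡ v x
restrict-below N v {x} x<N with x <ᵇ N | <⇒<ᵇ x<N
... | true | _ = refl

walks-even : ∀ N → Nilpotent N → ∀ k → N ≤ k → ∀ x y → x < N → parity (walks N k x y) ≡ 0ℙ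
walks-even N nil k N≤k x y x<N = begin
  parity (walks N k x y)                      ≡⟨ walks-parity N k y x ⟩
  fold v₀ A k x                               ≡⟨ cong (λ j → fold v₀ A j x) (sym (m+[n∸m]≡n N≤k)) ⟩
  fold v₀ A (N + (k ∸ N)) x                   ≡⟨ cong (λ w → w x) (fold-+ v₀ A N) ⟩
  fold (fold v₀ A (k ∸ N)) A N x              ≡⟨ sym (restrict-below N (fold (fold v₀ A (k ∸ N)) A N) x<N) ⟩
  restrict N (fold (fold v₀ A (k ∸ N)) A N) x ≡⟨ nil (fold v₀ A (k ∸ N)) x ⟩
  0ℙ ∎
  where
  A : Vector → Vector
  A = adjacency N
  v₀ : Vector
  v₀ z = parity (walks N zero z y)

parity-even : ∀ n → parity n ≡ 0ℙ → ∃ λ h → n ≡ 2 * h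
parity-even zero          _    = 0 , refl
parity-even (suc zero)    ()
parity-even (suc (suc n)) isEven with parity-even n isEven
... | h , n≡2h = suc h , trans (cong (2 +_) n≡2h) (sym (*-suc 2 h))

mainTheorem1 : (m : ℕ) → 1 ≤ m → (k : ℕ) → (2 ^ m ∸ 1) ≤ k →
    (x y : Fin (2 ^ m ∸ 1)) →
    ∃ λ c → Walk k x y ↔ Fin (2 * c)
mainTheorem1 m _ k N≤k x y =
  let h , count≡2h = parity-even (walks N k (toℕ x) (toℕ y)) evenCount
  in  h , subst (λ c → Walk k x y ↔ Fin c) count≡2h (Walk↔walks N k x y)
  where
  N : ℕ
  N = 2 ^ m ∸ 1
  evenCount : parity (walks N k (toℕ x) (toℕ y)) ≡ 0ℙ
  evenCount = walks-even N (nilpotent-2^m-1 m) k N≤k (toℕ x) (toℕ y) (toℕ<n x)
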